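{- Let $r_1,r_2,y\in\mathbb{N}$ satisfy $\phi(y)=\phi(R(r_1,r_2))$, $|W(y)|=4$, $v_2(y)=1$, $v_3(y)=0$ and $v_5(y)=0$. Then $y\le R(r_1,r_2)$.
   Context: $\phi$ is Euler's totient function; $R(r_1,r_2)=2\cdot3^{r_1}\cdot5^{r_2}$; $W(y)$ is the set of prime divisors of $y$; for a prime $p$, $v_p(y)$ is the largest $r\ge0$ with $p^r\mid y$. -}

module Defs where

open import Data.Nat using (ℕ; suc; _*_; _^_)
open import Data.Nat.Divisibility using (_∣_)
open import Data.Nat.Primality using (Prime)
open import Data.Nat.Coprimality using (Coprime; coprime?)
open import Data.List using (List; length; filter; upTo; map)
open import Data.List.Membership.Propositional using (_∈_)
open import Data.List.Relation.Unary.Unique.Propositional using (Unique)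
open import Data.Product using (_×_; Σ)
open import Relation.Binary.PropositionalEquality using (_≡_)
open import Relation.Nullary using (¬_)

-- Euler's totient: φ n = #{ k ∈ {1,…,n} : gcd(k,n) = 1 }  (so φ 0 = 0)
φ : ℕ → ℕ
φ n = length (filter (λ k → coprime? k n) (map suc (upTo n)))

R : ℕ → ℕ → ℕ
R r₁ r₂ = 2 * (3 ^ r₁) * (5 ^ r₂)

-- W y = set of prime divisors of y; "IsW y ps": the list ps enumerates W y without repetition
IsW : ℕ → List ℕ → Set
IsW y ps = Unique ps × (∀ p → p ∈ ps → Prime p × p ∣ y) × (∀ p → Prime p → p ∣ y → p ∈ ps)

CardW : ℕ → ℕ → Set
CardW y k = Σ (List ℕ) (λ ps → IsW y ps × length ps ≡ k)

-- v_p(y) = r  (largest r ≥ 0 with p^r ∣ y; meaningful for y ≠ 0)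
HasVal : ℕ → ℕ → ℕ → Set
HasVal p y r = (p ^ r) ∣ y × ¬ ((p ^ suc r) ∣ y)

{-# OPTIONS --safe #-}

-- Write y = 2m with m odd. Then φ(y) = φ(m), and m has exactly three prime divisors, all at
-- least 7. Peeling off one prime p at a time, φ(p^(a+1) n) = p^a (p − 1) φ(n) gives
-- 6³ m ≤ 7³ φ(m) (as 6p ≤ 7(p − 1) for p ≥ 7) and 2³ ∣ φ(m) (each p − 1 is even).
-- The divisibility forces r₁, r₂ ≥ 1, where φ(R) = (4/15) R; so m ≤ (7/6)³ (4/15) R < R/2.
module Submission where

open import Defs
import Algebra.Properties.CommutativeSemigroup
open import Data.Empty using (⊥-elim)
open import Data.List using (List; []; _∷_; _++_; length; filter; map; applyUpTo)
open import Data.List.Membership.Propositional using (_∈_)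
open import Data.List.Membership.Propositional.Properties using (∈-∃++)
open import Data.List.Properties using (map-applyUpTo)
open import Data.List.Relation.Binary.Permutation.Propositional using (_↭_; ↭-sym; ↭⇒↭ₛ)
open import Data.List.Relation.Binary.Permutation.Propositional.Properties
  using (∈-resp-↭; ↭-length; shift)
import Data.List.Relation.Binary.Permutation.Setoid.Properties as Permutationₛ
open import Data.List.Relation.Unary.All as All using (All; []; _∷_)
open import Data.List.Relation.Unary.AllPairs using (_∷_)
open import Data.List.Relation.Unary.Any using (here; there)
open import Data.Nat
open import Data.Nat.Coprimality as Coprimality
  using (Coprime; coprime?; coprime-+; coprime-divisor)
open import Data.Nat.Divisibility
open import Data.Nat.Induction using (<-wellFounded)
open import Data.Nat.ListAction using (product)
open import Data.Nat.Primality
open import Data.Nat.Primality.Factorisation using (factorise)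
open import Data.Nat.Properties
open import Data.Nat.Solver using (module +-*-Solver)
open import Data.Product using (∃-syntax; _×_; _,_; proj₁; proj₂)
open import Data.Sum using (_⊎_; inj₁; inj₂)
open import Function using (_∘_; id)
open import Induction.WellFounded using (Acc; acc)
open import Relation.Binary.PropositionalEquality
open import Relation.Nullary using (¬_; Dec; yes; no)
open import Relation.Nullary.Decidable using (from-yes; from-no)
open import Relation.Unary using (Pred; Decidable)

open +-*-Solver
open Permutationₛ (setoid ℕ) using (Unique-resp-↭)
open Algebra.Properties.CommutativeSemigroup +-commutativeSemigroup using (interchange)

∑< : ℕ → (ℕ → ℕ) → ℕ
∑< zero    f = 0
∑< (suc n) f = f 0 + ∑< n (f ∘ suc)

syntax ∑< n (λ i → e) = ∑[ i < n ] e

∑<-cong : ∀ n {f g : ℕ → ℕ} → (∀ i → i < n → f i ≡ g i) → ∑< n f ≡ ∑< n g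
∑<-cong zero    eq = refl
∑<-cong (suc n) eq = cong₂ _+_ (eq 0 z<s) (∑<-cong n (λ i i<n → eq (suc i) (s<s i<n)))

∑<-zero : ∀ n {f : ℕ → ℕ} → (∀ i → i < n → f i ≡ 0) → ∑< n f ≡ 0
∑<-zero zero    eq = refl
∑<-zero (suc n) eq = cong₂ _+_ (eq 0 z<s) (∑<-zero n (λ i i<n → eq (suc i) (s<s i<n)))

∑<-suc : ∀ n (f : ℕ → ℕ) → ∑< (suc n) f ≡ ∑< n f + f n
∑<-suc zero    f = +-identityʳ (f 0)
∑<-suc (suc n) f = trans (cong (f 0 +_) (∑<-suc n (f ∘ suc))) (sym (+-assoc (f 0) _ _))

∑<-+ : ∀ m n (f : ℕ → ℕ) → ∑< (m + n) f ≡ ∑< m f + ∑[ i < n ] f (m + i)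
∑<-+ zero    n f = refl
∑<-+ (suc m) n f = trans (cong (f 0 +_) (∑<-+ m n (f ∘ suc))) (sym (+-assoc (f 0) _ _))

∑<-distrib-+ : ∀ n (f g : ℕ → ℕ) → ∑[ i < n ] (f i + g i) ≡ ∑< n f + ∑< n g
∑<-distrib-+ zero    f g = refl
∑<-distrib-+ (suc n) f g = trans (cong (f 0 + g 0 +_) (∑<-distrib-+ n (f ∘ suc) (g ∘ suc)))
                                 (interchange (f 0) (g 0) _ _)

∑<-periodic : ∀ p n (f : ℕ → ℕ) → (∀ i → f (n + i) ≡ f i) → ∑< (p * n) f ≡ p * ∑< n f
∑<-periodic zero    n f per = refl
∑<-periodic (suc p) n f per = begin
  ∑< (n + p * n) f                      ≡⟨ ∑<-+ n (p * n) f ⟩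
  ∑< n f + ∑[ i < p * n ] f (n + i)     ≡⟨ cong (∑< n f +_) (∑<-cong (p * n) (λ i _ → per i)) ⟩
  ∑< n f + ∑< (p * n) f                 ≡⟨ cong (∑< n f +_) (∑<-periodic p n f per) ⟩
  ∑< n f + p * ∑< n f                   ∎
  where open ≡-Reasoning

𝟙 : ∀ {P : Set} → Dec P → ℕ
𝟙 (yes _) = 1
𝟙 (no _)  = 0

𝟙-yes : ∀ {P : Set} (P? : Dec P) → P → 𝟙 P? ≡ 1
𝟙-yes (yes _) _ = refl
𝟙-yes (no ¬p) p = ⊥-elim (¬p p)

𝟙-no : ∀ {P : Set} (P? : Dec P) → ¬ P → 𝟙 P? ≡ 0
𝟙-no (yes p) ¬p = ⊥-elim (¬p p)
𝟙-no (no _)  _  = refl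

𝟙-cong : ∀ {P Q : Set} (P? : Dec P) (Q? : Dec Q) → (P → Q) → (Q → P) → 𝟙 P? ≡ 𝟙 Q?
𝟙-cong (yes _) (yes _) _   _   = refl
𝟙-cong (yes p) (no ¬q) p→q _   = ⊥-elim (¬q (p→q p))
𝟙-cong (no ¬p) (yes q) _   q→p = ⊥-elim (¬p (q→p q))
𝟙-cong (no _)  (no _)  _   _   = refl

length-filter-applyUpTo : ∀ {Q : Pred ℕ _} (Q? : Decidable Q) (g : ℕ → ℕ) n →
  length (filter Q? (applyUpTo g n)) ≡ ∑[ i < n ] 𝟙 (Q? (g i))
length-filter-applyUpTo Q? g zero = refl
length-filter-applyUpTo Q? g (suc n) with Q? (g 0)
... | yes _ = cong suc (length-filter-applyUpTo Q? (g ∘ suc) n)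
... | no _  = length-filter-applyUpTo Q? (g ∘ suc) n

prime>1 : ∀ {p} → Prime p → 1 < p
prime>1 {p} pp = nonTrivial⇒n>1 p {{prime⇒nonTrivial pp}}

prime≢1 : ∀ {p} → Prime p → p ≢ 1
prime≢1 pp refl = ¬prime[1] pp

prime∣prime⇒≡ : ∀ {q p} → Prime q → Prime p → q ∣ p → q ≡ p
prime∣prime⇒≡ qq pp q∣p with prime⇒irreducible pp q∣p
... | inj₁ refl = ⊥-elim (¬prime[1] qq)
... | inj₂ q≡p  = q≡p

prime∣^⇒∣ : ∀ {q p} → Prime q → ∀ k → q ∣ p ^ k → q ∣ p
prime∣^⇒∣ qq zero    q∣1 = ⊥-elim (prime≢1 qq (∣1⇒≡1 q∣1))
prime∣^⇒∣ {p = p} qq (suc k) q∣p^[1+k] with euclidsLemma p (p ^ k) qq q∣p^[1+k]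
... | inj₁ q∣p   = q∣p
... | inj₂ q∣p^k = prime∣^⇒∣ qq k q∣p^k

2∣n⊎2∣1+n : ∀ n → 2 ∣ n ⊎ 2 ∣ suc n
2∣n⊎2∣1+n zero = inj₁ (2 ∣0)
2∣n⊎2∣1+n (suc n) with 2∣n⊎2∣1+n n
... | inj₁ 2∣n   = inj₂ (∣m∣n⇒∣m+n (∣-refl {2}) 2∣n)
... | inj₂ 2∣1+n = inj₁ 2∣1+n

prime≢2⇒2∣pred : ∀ {p} → Prime p → p ≢ 2 → 2 ∣ pred p
prime≢2⇒2∣pred {zero}  pp _   = ⊥-elim (¬prime[0] pp)
prime≢2⇒2∣pred {suc q} pp p≢2 with 2∣n⊎2∣1+n q
... | inj₁ 2∣q = 2∣q
... | inj₂ 2∣p = ⊥-elim (p≢2 (sym (prime∣prime⇒≡ prime[2] pp 2∣p)))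

prime≢2,3,5⇒7≤ : ∀ {r} → Prime r → r ≢ 2 → r ≢ 3 → r ≢ 5 → 7 ≤ r
prime≢2,3,5⇒7≤ {0} pp _ _ _ = ⊥-elim (¬prime[0] pp)
prime≢2,3,5⇒7≤ {1} pp _ _ _ = ⊥-elim (¬prime[1] pp)
prime≢2,3,5⇒7≤ {2} _ r≢2 _ _ = ⊥-elim (r≢2 refl)
prime≢2,3,5⇒7≤ {3} _ _ r≢3 _ = ⊥-elim (r≢3 refl)
prime≢2,3,5⇒7≤ {4} pp _ _ _ = ⊥-elim (composite⇒¬prime composite[4] pp)
prime≢2,3,5⇒7≤ {5} _ _ _ r≢5 = ⊥-elim (r≢5 refl)
prime≢2,3,5⇒7≤ {6} pp _ _ _ = ⊥-elim (composite⇒¬prime composite[6] pp)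
prime≢2,3,5⇒7≤ {suc (suc (suc (suc (suc (suc (suc _))))))} _ _ _ _ =
  s≤s (s≤s (s≤s (s≤s (s≤s (s≤s (s≤s z≤n))))))

7≤p⇒6*p≤7*pred[p] : ∀ {p} → 7 ≤ p → 6 * p ≤ 7 * pred p
7≤p⇒6*p≤7*pred[p] {suc q} (s≤s 6≤q) = begin
  6 * suc q   ≡⟨ *-suc 6 q ⟩
  6 + 6 * q   ≤⟨ +-monoˡ-≤ (6 * q) 6≤q ⟩
  q + 6 * q   ≡⟨ solve 1 (λ x → x :+ con 6 :* x := con 7 :* x) refl q ⟩
  7 * q       ∎
  where open ≤-Reasoning

coprime-* : ∀ {k a b} → Coprime k a → Coprime k b → Coprime k (a * b)
coprime-* ka kb (d∣k , d∣ab) =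
  kb (d∣k , coprime-divisor (λ (e∣d , e∣a) → ka (∣-trans e∣d d∣k , e∣a)) d∣ab)

coprime-*⁻ʳ : ∀ {k a b} → Coprime k (a * b) → Coprime k b
coprime-*⁻ʳ {a = a} k⊥ab (d∣k , d∣b) = k⊥ab (d∣k , ∣-trans d∣b (n∣m*n a))

coprime-∣ˡ : ∀ {k j n} → Coprime k n → j ∣ k → Coprime j n
coprime-∣ˡ k⊥n j∣k (d∣j , d∣n) = k⊥n (∣-trans d∣j j∣k , d∣n)

∤⇒coprime : ∀ {p k} → Prime p → ¬ p ∣ k → Coprime k p
∤⇒coprime pp p∤k (d∣k , d∣p) with prime⇒irreducible pp d∣p
... | inj₁ d≡1 = d≡1
... | inj₂ refl = ⊥-elim (p∤k d∣k)

-- φ counts the residues 1, …, n; as gcd(n, n) = gcd(0, n), we may count 0, …, n − 1 instead.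
φ≡∑coprime : ∀ n → φ n ≡ ∑[ k < n ] 𝟙 (coprime? k n)
φ≡∑coprime zero    = refl
φ≡∑coprime (suc m) = begin
  length (filter (λ k → coprime? k n) (map suc (applyUpTo id n)))
    ≡⟨ cong (λ ks → length (filter (λ k → coprime? k n) ks)) (map-applyUpTo id suc n) ⟩
  length (filter (λ k → coprime? k n) (applyUpTo suc n))
    ≡⟨ length-filter-applyUpTo (λ k → coprime? k n) suc n ⟩
  ∑[ i < n ] c (suc i)           ≡⟨ ∑<-suc m (c ∘ suc) ⟩
  ∑[ i < m ] c (suc i) + c n     ≡⟨ cong (∑[ i < m ] c (suc i) +_) c[n]≡c[0] ⟩
  ∑[ i < m ] c (suc i) + c 0     ≡⟨ +-comm _ (c 0) ⟩
  c 0 + ∑[ i < m ] c (suc i)     ∎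
  where
  open ≡-Reasoning
  n = suc m
  c : ℕ → ℕ
  c k = 𝟙 (coprime? k n)
  c[n]≡c[0] : c n ≡ c 0
  c[n]≡c[0] = 𝟙-cong (coprime? n n) (coprime? 0 n)
    (λ n⊥n (_ , d∣n) → n⊥n (d∣n , d∣n)) (λ 0⊥n (d∣n , _) → 0⊥n (_ ∣0 , d∣n))

∑<-multiples : ∀ p .{{_ : NonZero p}} n (h : ℕ → ℕ) →
  ∑[ k < n * p ] (h k * 𝟙 (p ∣? k)) ≡ ∑[ j < n ] h (j * p)
∑<-multiples p         zero    h = refl
∑<-multiples p@(suc q) (suc n) h = begin
  ∑< (p + n * p) g
    ≡⟨ ∑<-+ p (n * p) g ⟩
  ∑< p g + ∑[ i < n * p ] g (p + i)
    ≡⟨ cong₂ _+_ first-period (∑<-cong (n * p) shift-period) ⟩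
  h 0 + ∑[ i < n * p ] (h (p + i) * 𝟙 (p ∣? i))
    ≡⟨ cong (h 0 +_) (∑<-multiples p n (λ i → h (p + i))) ⟩
  h 0 + ∑[ j < n ] h (p + j * p)
    ∎
  where
  open ≡-Reasoning
  g : ℕ → ℕ
  g k = h k * 𝟙 (p ∣? k)
  first-period : ∑< p g ≡ h 0
  first-period = begin
    h 0 * 𝟙 (p ∣? 0) + ∑[ i < q ] g (suc i)
      ≡⟨ cong₂ _+_ (cong (h 0 *_) (𝟙-yes (p ∣? 0) (p ∣0)))
                   (∑<-zero q (λ i i<q → trans (cong (h (suc i) *_) (𝟙-no (p ∣? suc i)
                      (λ p∣1+i → <⇒≱ (s<s i<q) (∣⇒≤ p∣1+i)))) (*-zeroʳ (h (suc i))))) ⟩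
    h 0 * 1 + 0  ≡⟨ trans (+-identityʳ _) (*-identityʳ _) ⟩
    h 0          ∎
  shift-period : ∀ i → i < n * p → g (p + i) ≡ h (p + i) * 𝟙 (p ∣? i)
  shift-period i _ = cong (h (p + i) *_)
    (𝟙-cong (p ∣? (p + i)) (p ∣? i) (λ p∣p+i → ∣m+n∣m⇒∣n p∣p+i ∣-refl) (∣m∣n⇒∣m+n ∣-refl))

coprime-split : ∀ {p} → Prime p → ∀ n k →
  𝟙 (coprime? k n) ≡ 𝟙 (coprime? k (p * n)) + 𝟙 (coprime? k n) * 𝟙 (p ∣? k)
coprime-split {p} pp n k with p ∣? k
... | yes p∣k = begin
  𝟙 (coprime? k n)                                ≡⟨ sym (*-identityʳ _) ⟩
  𝟙 (coprime? k n) * 1                            ≡⟨ cong (_+ 𝟙 (coprime? k n) * 1) k⊥pn≡0 ⟨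
  𝟙 (coprime? k (p * n)) + 𝟙 (coprime? k n) * 1   ∎
  where
  open ≡-Reasoning
  k⊥pn≡0 : 𝟙 (coprime? k (p * n)) ≡ 0
  k⊥pn≡0 = 𝟙-no (coprime? k (p * n)) (λ k⊥pn → prime≢1 pp (k⊥pn (p∣k , m∣m*n n)))
... | no p∤k = begin
  𝟙 (coprime? k n)
    ≡⟨ 𝟙-cong (coprime? k n) (coprime? k (p * n))
              (coprime-* (∤⇒coprime pp p∤k)) (coprime-*⁻ʳ {a = p}) ⟩
  𝟙 (coprime? k (p * n))
    ≡⟨ +-identityʳ (𝟙 (coprime? k (p * n))) ⟨
  𝟙 (coprime? k (p * n)) + 0
    ≡⟨ cong (𝟙 (coprime? k (p * n)) +_) (*-zeroʳ (𝟙 (coprime? k n))) ⟨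
  𝟙 (coprime? k (p * n)) + 𝟙 (coprime? k n) * 0
    ∎
  where open ≡-Reasoning

-- Count the residues mod pn coprime to n in two ways: p copies of those mod n, or those
-- coprime to pn together with the multiples jp of p.
p*φ[n]≡φ[p*n]+∑coprime[j*p] : ∀ {p} → Prime p → ∀ n →
  p * φ n ≡ φ (p * n) + ∑[ j < n ] 𝟙 (coprime? (j * p) n)
p*φ[n]≡φ[p*n]+∑coprime[j*p] {p} pp n = begin
  p * φ n                                 ≡⟨ cong (p *_) (φ≡∑coprime n) ⟩
  p * ∑< n c                              ≡⟨ ∑<-periodic p n c periodic ⟨
  ∑< (p * n) c                            ≡⟨ ∑<-cong (p * n) (λ k _ → coprime-split pp n k) ⟩
  ∑[ k < p * n ] (c′ k + c k * 𝟙 (p ∣? k)) ≡⟨ ∑<-distrib-+ (p * n) c′ (λ k → c k * 𝟙 (p ∣? k)) ⟩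
  ∑< (p * n) c′ + ∑[ k < p * n ] (c k * 𝟙 (p ∣? k))
    ≡⟨ cong₂ _+_ (φ≡∑coprime (p * n)) (cong (λ m → ∑[ k < m ] (c k * 𝟙 (p ∣? k))) (*-comm n p)) ⟨
  φ (p * n) + ∑[ k < n * p ] (c k * 𝟙 (p ∣? k))
    ≡⟨ cong (φ (p * n) +_) (∑<-multiples p {{prime⇒nonZero pp}} n c) ⟩
  φ (p * n) + ∑[ j < n ] c (j * p)        ∎
  where
  open ≡-Reasoning
  c c′ : ℕ → ℕ
  c  k = 𝟙 (coprime? k n)
  c′ k = 𝟙 (coprime? k (p * n))
  periodic : ∀ i → c (n + i) ≡ c i
  periodic i = 𝟙-cong (coprime? (n + i) n) (coprime? i n)
    (λ n+i⊥n (d∣i , d∣n) → n+i⊥n (∣m∣n⇒∣m+n d∣n d∣i , d∣n)) coprime-+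

p∤n⇒φ[p*n]≡pred[p]*φ[n] : ∀ {p n} → Prime p → ¬ p ∣ n → φ (p * n) ≡ pred p * φ n
p∤n⇒φ[p*n]≡pred[p]*φ[n] {zero}  pp _ = ⊥-elim (¬prime[0] pp)
p∤n⇒φ[p*n]≡pred[p]*φ[n] {suc q} {n} pp p∤n = +-cancelʳ-≡ (φ n) _ _ (begin
  φ (p * n) + φ n
    ≡⟨ cong (φ (p * n) +_) (trans (φ≡∑coprime n) (∑<-cong n j*p⊥n≡j⊥n)) ⟩
  φ (p * n) + ∑[ j < n ] 𝟙 (coprime? (j * p) n)
    ≡⟨ p*φ[n]≡φ[p*n]+∑coprime[j*p] pp n ⟨
  p * φ n
    ≡⟨ +-comm (φ n) (q * φ n) ⟩
  q * φ n + φ n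
    ∎)
  where
  open ≡-Reasoning
  p = suc q
  j*p⊥n≡j⊥n : ∀ j → j < n → 𝟙 (coprime? j n) ≡ 𝟙 (coprime? (j * p) n)
  j*p⊥n≡j⊥n j _ = 𝟙-cong (coprime? j n) (coprime? (j * p) n)
    (λ j⊥n → Coprimality.sym (coprime-* (Coprimality.sym j⊥n) (∤⇒coprime pp p∤n)))
    (λ jp⊥n → coprime-∣ˡ jp⊥n (m∣m*n p))

p∣n⇒φ[p*n]≡p*φ[n] : ∀ {p n} → Prime p → p ∣ n → φ (p * n) ≡ p * φ n
p∣n⇒φ[p*n]≡p*φ[n] {p} {n} pp p∣n = sym (begin
  p * φ n                                         ≡⟨ p*φ[n]≡φ[p*n]+∑coprime[j*p] pp n ⟩
  φ (p * n) + ∑[ j < n ] 𝟙 (coprime? (j * p) n)   ≡⟨ cong (φ (p * n) +_) (∑<-zero n j*p⊥n≡0) ⟩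
  φ (p * n) + 0                                   ≡⟨ +-identityʳ (φ (p * n)) ⟩
  φ (p * n)                                       ∎)
  where
  open ≡-Reasoning
  j*p⊥n≡0 : ∀ j → j < n → 𝟙 (coprime? (j * p) n) ≡ 0
  j*p⊥n≡0 j _ = 𝟙-no (coprime? (j * p) n) (λ jp⊥n → prime≢1 pp (jp⊥n (n∣m*n j , p∣n)))

φ[p^[1+a]*n]≡p^a*pred[p]*φ[n] : ∀ {p n} → Prime p → ¬ p ∣ n → ∀ a →
  φ (p ^ suc a * n) ≡ p ^ a * (pred p * φ n)
φ[p^[1+a]*n]≡p^a*pred[p]*φ[n] {p} {n} pp p∤n zero = begin
  φ (p * 1 * n)       ≡⟨ cong (λ m → φ (m * n)) (*-identityʳ p) ⟩
  φ (p * n)           ≡⟨ p∤n⇒φ[p*n]≡pred[p]*φ[n] pp p∤n ⟩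
  pred p * φ n        ≡⟨ *-identityˡ (pred p * φ n) ⟨
  1 * (pred p * φ n)  ∎
  where open ≡-Reasoning
φ[p^[1+a]*n]≡p^a*pred[p]*φ[n] {p} {n} pp p∤n (suc a) = begin
  φ (p * p ^ suc a * n)          ≡⟨ cong φ (*-assoc p (p ^ suc a) n) ⟩
  φ (p * (p ^ suc a * n))        ≡⟨ p∣n⇒φ[p*n]≡p*φ[n] pp (∣m⇒∣m*n n (m∣m*n (p ^ a))) ⟩
  p * φ (p ^ suc a * n)          ≡⟨ cong (p *_) (φ[p^[1+a]*n]≡p^a*pred[p]*φ[n] pp p∤n a) ⟩
  p * (p ^ a * (pred p * φ n))   ≡⟨ *-assoc p (p ^ a) (pred p * φ n) ⟨
  p ^ suc a * (pred p * φ n)     ∎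
  where open ≡-Reasoning

p-adic-split : ∀ {p} → Prime p → ∀ n .{{_ : NonZero n}} → ∃[ a ] ∃[ m ] n ≡ p ^ a * m × ¬ p ∣ m
p-adic-split {p} pp n = go n (<-wellFounded n)
  where
  go : ∀ n → Acc _<_ n → .{{NonZero n}} → ∃[ a ] ∃[ m ] n ≡ p ^ a * m × ¬ p ∣ m
  go n _ with p ∣? n
  go n _ | no p∤n = 0 , n , sym (*-identityˡ n) , p∤n
  go .(q * p) (acc rec) | yes (divides-refl q) with go q (rec q<q*p) {{q≢0}}
    where
    q≢0 : NonZero q
    q≢0 = m*n≢0⇒m≢0 q
    q<q*p : q < q * p
    q<q*p = m<m*n q p {{q≢0}} (prime>1 pp)
  ... | a , m , refl , p∤m =
    suc a , m , solve 3 (λ x y z → x :* y :* z := z :* x :* y) refl (p ^ a) m p , p∤m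

IsW-resp-↭ : ∀ {y ps qs} → ps ↭ qs → IsW y ps → IsW y qs
IsW-resp-↭ ps↭qs (unique , prime-divisor , complete) =
  Unique-resp-↭ (↭⇒↭ₛ ps↭qs) unique ,
  (λ p p∈qs → prime-divisor p (∈-resp-↭ (↭-sym ps↭qs) p∈qs)) ,
  (λ p pp p∣y → ∈-resp-↭ ps↭qs (complete p pp p∣y))

IsW-strip : ∀ {p n ps} a → Prime p → ¬ p ∣ n → IsW (p ^ suc a * n) (p ∷ ps) → IsW n ps
IsW-strip {p} {n} {ps} a pp p∤n (p∉ps ∷ unique , prime-divisor , complete) =
  unique , prime-divisor′ , complete′
  where
  prime-divisor′ : ∀ r → r ∈ ps → Prime r × r ∣ n
  prime-divisor′ r r∈ps with prime-divisor r (there r∈ps)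
  ... | rp , r∣p^[1+a]*n with euclidsLemma (p ^ suc a) n rp r∣p^[1+a]*n
  ...   | inj₂ r∣n = rp , r∣n
  ...   | inj₁ r∣p^[1+a] =
    ⊥-elim (All.lookup p∉ps r∈ps (sym (prime∣prime⇒≡ rp pp (prime∣^⇒∣ rp (suc a) r∣p^[1+a]))))
  complete′ : ∀ q → Prime q → q ∣ n → q ∈ ps
  complete′ q qp q∣n with complete q qp (∣n⇒∣m*n (p ^ suc a) q∣n)
  ... | here refl = ⊥-elim (p∤n q∣n)
  ... | there q∈ps = q∈ps

IsW[]⇒≡1 : ∀ n .{{_ : NonZero n}} → IsW n [] → n ≡ 1
IsW[]⇒≡1 n (_ , _ , complete) with factorise n
... | record { factors = [] ; isFactorisation = n≡1 } = n≡1
... | record { factors = p ∷ ps ; isFactorisation = n≡p*∏ps ; factorsPrime = pp ∷ _ }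
  with complete p pp (subst (p ∣_) (sym n≡p*∏ps) (m∣m*n (product ps)))
... | ()

IsW-induction : (P : List ℕ → ℕ → Set) → P [] 1 →
  (∀ {p ps n} a → Prime p → ¬ p ∣ n → P ps n → P (p ∷ ps) (p ^ suc a * n)) →
  ∀ ps n .{{_ : NonZero n}} → IsW n ps → P ps n
IsW-induction P base step []       n w = subst (P []) (sym (IsW[]⇒≡1 n w)) base
IsW-induction P base step (p ∷ ps) n w@(_ , prime-divisor , _)
  with prime-divisor p (here refl)
... | pp , p∣n with p-adic-split pp n
...   | zero , m , refl , p∤m = ⊥-elim (p∤m (subst (p ∣_) (*-identityˡ m) p∣n))
...   | suc a , m , refl , p∤m =
  step a pp p∤m (IsW-induction P base step ps m {{m*n≢0⇒n≢0 (p ^ suc a)}} (IsW-strip a pp p∤m w))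

IsW⇒d^k∣φ : ∀ d ps n .{{_ : NonZero n}} → IsW n ps → All (λ p → d ∣ pred p) ps → d ^ length ps ∣ φ n
IsW⇒d^k∣φ d = IsW-induction P (λ _ → 1∣ φ 1) step
  where
  P : List ℕ → ℕ → Set
  P ps n = All (λ p → d ∣ pred p) ps → d ^ length ps ∣ φ n
  step : ∀ {p ps n} a → Prime p → ¬ p ∣ n → P ps n → P (p ∷ ps) (p ^ suc a * n)
  step {p} {ps} a pp p∤n ih (d∣p-1 ∷ ds) =
    subst (d ^ suc (length ps) ∣_) (sym (φ[p^[1+a]*n]≡p^a*pred[p]*φ[n] pp p∤n a))
          (∣n⇒∣m*n (p ^ a) (*-pres-∣ d∣p-1 (ih ds)))

IsW⇒c^k*n≤d^k*φ : ∀ c d ps n .{{_ : NonZero n}} → IsW n ps → All (λ p → c * p ≤ d * pred p) ps →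
  c ^ length ps * n ≤ d ^ length ps * φ n
IsW⇒c^k*n≤d^k*φ c d = IsW-induction P (λ _ → ≤-refl) step
  where
  P : List ℕ → ℕ → Set
  P ps n = All (λ p → c * p ≤ d * pred p) ps → c ^ length ps * n ≤ d ^ length ps * φ n
  step : ∀ {p ps n} a → Prime p → ¬ p ∣ n → P ps n → P (p ∷ ps) (p ^ suc a * n)
  step {p} {ps} {n} a pp p∤n ih (cp≤d[p-1] ∷ bounds) = begin
    c ^ suc k * (p ^ suc a * n)
      ≡⟨ solve 5 (λ C K P A N → (C :* K) :* (P :* A :* N) := A :* ((C :* P) :* (K :* N)))
               refl c (c ^ k) p (p ^ a) n ⟩
    p ^ a * ((c * p) * (c ^ k * n))
      ≤⟨ *-monoʳ-≤ (p ^ a) (*-mono-≤ cp≤d[p-1] (ih bounds)) ⟩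
    p ^ a * ((d * pred p) * (d ^ k * φ n))
      ≡⟨ solve 5 (λ D L Q A F → A :* ((D :* Q) :* (L :* F)) := (D :* L) :* (A :* (Q :* F)))
               refl d (d ^ k) (pred p) (p ^ a) (φ n) ⟩
    d ^ suc k * (p ^ a * (pred p * φ n))
      ≡⟨ cong (d ^ suc k *_) (φ[p^[1+a]*n]≡p^a*pred[p]*φ[n] pp p∤n a) ⟨
    d ^ suc k * φ (p ^ suc a * n) ∎
    where
    open ≤-Reasoning
    k = length ps

prime[3] : Prime 3
prime[3] = from-yes (prime? 3)

prime[5] : Prime 5
prime[5] = from-yes (prime? 5)

5∤2*3^a : ∀ a → ¬ 5 ∣ 2 * 3 ^ a
5∤2*3^a a 5∣2*3^a with euclidsLemma 2 (3 ^ a) prime[5] 5∣2*3^a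
... | inj₁ 5∣2   = from-no (5 ∣? 2) 5∣2
... | inj₂ 5∣3^a = from-no (5 ∣? 3) (prime∣^⇒∣ prime[5] a 5∣3^a)

φ[2*3^[1+a]] : ∀ a → φ (2 * 3 ^ suc a) ≡ 3 ^ a * 2
φ[2*3^[1+a]] a = trans (cong φ (*-comm 2 (3 ^ suc a)))
  (φ[p^[1+a]*n]≡p^a*pred[p]*φ[n] prime[3] (from-no (3 ∣? 2)) a)

φ[R[r₁,1+b]] : ∀ r₁ b → φ (R r₁ (suc b)) ≡ 5 ^ b * (4 * φ (2 * 3 ^ r₁))
φ[R[r₁,1+b]] r₁ b =
  trans (cong φ (*-comm (2 * 3 ^ r₁) (5 ^ suc b)))
        (φ[p^[1+a]*n]≡p^a*pred[p]*φ[n] prime[5] (5∤2*3^a r₁) b)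

8∣φ[R]⇒15*φ[R]≡4*R : ∀ r₁ r₂ → 8 ∣ φ (R r₁ r₂) → 15 * φ (R r₁ r₂) ≡ 4 * R r₁ r₂
8∣φ[R]⇒15*φ[R]≡4*R zero zero 8∣1 with ∣1⇒≡1 8∣1
... | ()
8∣φ[R]⇒15*φ[R]≡4*R (suc a) zero 8∣φ[R] = ⊥-elim (from-no (2 ∣? 3) (prime∣^⇒∣ prime[2] a 2∣3^a))
  where
  4*2∣3^a*2 : 4 * 2 ∣ 3 ^ a * 2
  4*2∣3^a*2 = subst (8 ∣_) (trans (cong φ (*-identityʳ (2 * 3 ^ suc a))) (φ[2*3^[1+a]] a)) 8∣φ[R]
  2∣3^a : 2 ∣ 3 ^ a
  2∣3^a = ∣-trans (divides 2 refl) (*-cancelʳ-∣ 2 4*2∣3^a*2)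
8∣φ[R]⇒15*φ[R]≡4*R zero (suc b) 8∣φ[R] = ⊥-elim (from-no (2 ∣? 5) (prime∣^⇒∣ prime[2] b 2∣5^b))
  where
  2*4∣5^b*4 : 2 * 4 ∣ 5 ^ b * 4
  2*4∣5^b*4 = subst (8 ∣_) (φ[R[r₁,1+b]] 0 b) 8∣φ[R]
  2∣5^b : 2 ∣ 5 ^ b
  2∣5^b = *-cancelʳ-∣ 4 2*4∣5^b*4
8∣φ[R]⇒15*φ[R]≡4*R (suc a) (suc b) _ = begin
  15 * φ (R (suc a) (suc b))            ≡⟨ cong (15 *_) (φ[R[r₁,1+b]] (suc a) b) ⟩
  15 * (5 ^ b * (4 * φ (2 * 3 ^ suc a))) ≡⟨ cong (λ x → 15 * (5 ^ b * (4 * x))) (φ[2*3^[1+a]] a) ⟩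
  15 * (5 ^ b * (4 * (3 ^ a * 2)))
    ≡⟨ solve 2 (λ A B → con 15 :* (B :* (con 4 :* (A :* con 2)))
                       := con 4 :* (con 2 :* (con 3 :* A) :* (con 5 :* B))) refl (3 ^ a) (5 ^ b) ⟩
  4 * R (suc a) (suc b)                 ∎
  where open ≡-Reasoning

IsW-7≤⇒φ-bounds : ∀ ps n .{{_ : NonZero n}} → IsW n ps → All (7 ≤_) ps →
  6 ^ length ps * n ≤ 7 ^ length ps * φ n × 2 ^ length ps ∣ φ n
IsW-7≤⇒φ-bounds ps n W@(_ , prime-divisor , _) 7≤ps =
  IsW⇒c^k*n≤d^k*φ 6 7 ps n W (All.map 7≤p⇒6*p≤7*pred[p] 7≤ps) ,
  IsW⇒d^k∣φ 2 ps n W (All.tabulate λ {p} p∈ps →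
    prime≢2⇒2∣pred (proj₁ (prime-divisor p p∈ps))
                   (λ { refl → from-no (7 ≤? 2) (All.lookup 7≤ps p∈ps) }))

IsW-2,3,5∤⇒7≤ : ∀ {n ps} → IsW n ps → ¬ 2 ∣ n → ¬ 3 ∣ n → ¬ 5 ∣ n → All (7 ≤_) ps
IsW-2,3,5∤⇒7≤ (_ , prime-divisor , _) 2∤n 3∤n 5∤n = All.tabulate λ {r} r∈ps →
  let rp , r∣n = prime-divisor r r∈ps in
  prime≢2,3,5⇒7≤ rp (λ { refl → 2∤n r∣n }) (λ { refl → 3∤n r∣n }) (λ { refl → 5∤n r∣n })

IsW-remove : ∀ {p n ps} a → Prime p → ¬ p ∣ n → IsW (p ^ suc a * n) ps →
  ∃[ ws ] IsW n ws × length ps ≡ suc (length ws)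
IsW-remove {p} {n} a pp p∤n W@(_ , _ , complete)
  with ∈-∃++ (complete p pp (∣m⇒∣m*n n (m∣m*n (p ^ a))))
... | xs , zs , refl =
  xs ++ zs , IsW-strip a pp p∤n (IsW-resp-↭ (shift p xs zs) W) , ↭-length (shift p xs zs)

6^3*m≤7^3*φ[R]⇒m*2≤R : ∀ r₁ r₂ m → 6 ^ 3 * m ≤ 7 ^ 3 * φ (R r₁ r₂) → 2 ^ 3 ∣ φ (R r₁ r₂) →
  m * 2 ≤ R r₁ r₂
6^3*m≤7^3*φ[R]⇒m*2≤R r₁ r₂ m 216m≤343φ[R] 8∣φ[R] = *-cancelˡ-≤ 3240 (begin
  3240 * (m * 2)
    ≡⟨ solve 1 (λ x → con 3240 :* (x :* con 2) := con 30 :* (con 216 :* x)) refl m ⟩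
  30 * (216 * m)
    ≤⟨ *-monoʳ-≤ 30 216m≤343φ[R] ⟩
  30 * (343 * φ (R r₁ r₂))
    ≡⟨ solve 1 (λ x → con 30 :* (con 343 :* x) := con 686 :* (con 15 :* x)) refl (φ (R r₁ r₂)) ⟩
  686 * (15 * φ (R r₁ r₂))
    ≡⟨ cong (686 *_) (8∣φ[R]⇒15*φ[R]≡4*R r₁ r₂ 8∣φ[R]) ⟩
  686 * (4 * R r₁ r₂)
    ≡⟨ *-assoc 686 4 (R r₁ r₂) ⟨
  2744 * R r₁ r₂
    ≤⟨ *-monoˡ-≤ (R r₁ r₂) (from-yes (2744 ≤? 3240)) ⟩
  3240 * R r₁ r₂
    ∎)
  where open ≤-Reasoning

lemma3p11 : (r₁ r₂ y : ℕ) → φ y ≡ φ (R r₁ r₂) → CardW y 4 →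
    HasVal 2 y 1 → HasVal 3 y 0 → HasVal 5 y 0 → y ≤ R r₁ r₂
lemma3p11 r₁ r₂ _ φ[y]≡φ[R] (ps , W[y] , |ps|≡4) (divides-refl m , 4∤y) (_ , 3∤y) (_ , 5∤y) =
  6^3*m≤7^3*φ[R]⇒m*2≤R r₁ r₂ m
    (subst₂ (λ k x → 6 ^ k * m ≤ 7 ^ k * x) |ws|≡3 φ[m]≡φ[R] (proj₁ bounds))
    (subst₂ (λ k x → 2 ^ k ∣ x) |ws|≡3 φ[m]≡φ[R] (proj₂ bounds))
  where
  2∤m : ¬ 2 ∣ m
  2∤m 2∣m = 4∤y (*-monoˡ-∣ 2 2∣m)
  instance
    m≢0 : NonZero m
    m≢0 = ≢-nonZero (λ { refl → 2∤m (2 ∣0) })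
  odd-part : ∃[ ws ] IsW m ws × length ps ≡ suc (length ws)
  odd-part = IsW-remove 0 prime[2] 2∤m (subst (λ y → IsW y ps) (*-comm m 2) W[y])
  ws : List ℕ
  ws = proj₁ odd-part
  |ws|≡3 : length ws ≡ 3
  |ws|≡3 = suc-injective (trans (sym (proj₂ (proj₂ odd-part))) |ps|≡4)
  bounds : 6 ^ length ws * m ≤ 7 ^ length ws * φ m × 2 ^ length ws ∣ φ m
  bounds = IsW-7≤⇒φ-bounds ws m (proj₁ (proj₂ odd-part))
    (IsW-2,3,5∤⇒7≤ (proj₁ (proj₂ odd-part)) 2∤m (3∤y ∘ ∣m⇒∣m*n 2) (5∤y ∘ ∣m⇒∣m*n 2))
  φ[m]≡φ[R] : φ m ≡ φ (R r₁ r₂)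
  φ[m]≡φ[R] = begin
    φ m           ≡⟨ *-identityˡ (φ m) ⟨
    1 * φ m       ≡⟨ p∤n⇒φ[p*n]≡pred[p]*φ[n] prime[2] 2∤m ⟨
    φ (2 * m)     ≡⟨ cong φ (*-comm 2 m) ⟩
    φ (m * 2)     ≡⟨ φ[y]≡φ[R] ⟩
    φ (R r₁ r₂)   ∎
    where open ≡-Reasoning
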